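{- Let $A = (\Sigma,G,\mathcal{I})$ be a non-interactive proto-algorithm, where $\Sigma = (F,P)$, $G = (V,E,L_v,L_e,l,r)$, and $\mathcal{I} = (D,D_{\mathrm{in}},D_{\mathrm{out}},I)$. Moreover, let $A' = (\Sigma',G',\mathcal{I}')$ be an interactive proto-algorithm, where $\Sigma' = (F \cup \{\mathsf{inp},\mathsf{outp}\},P)$, $G' = (V,E,L_v',L_e,l',r)$ with $L_v' = L_v \cup \{\mathsf{inp},\mathsf{outp}\}$ and $l'$ such that $l$ is $l'$ restricted to $L_v \cup L_e$, and $\mathcal{I}' = (D,D_{\mathrm{in}},D_{\mathrm{out}},I')$ with $I'$ such that $I$ is $I'$ restricted to $L_v \cup L_e$. Then: (i) for all states $s,s'$ of $A$, $s' \in \mathrm{astep}_A(s)$ iff $s' \in \mathrm{astep}_{A'}(s)$; (ii) for all $d_{\mathrm{in}} \in D_{\mathrm{in}}$ and $d_{\mathrm{out}} \in D_{\mathrm{out}}$, $(d_{\mathrm{in}},d_{\mathrm{out}}) \in \widehat{A}$ iff $(\langle d_{\mathrm{in}}\rangle,\langle d_{\mathrm{out}}\rangle) \in \widehat{A'}$.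
   Context: A non-interactive alphabet is a pair $(F,P)$ of disjoint countable sets of function and predicate symbols with special symbols $\mathsf{ini},\mathsf{fin} \in F$; an interactive alphabet additionally contains special symbols $\mathsf{inp},\mathsf{outp} \in F$. $\widetilde{F}$ denotes $F$ minus the special symbols. A ($\Sigma$-)algorithm graph is a finite rooted labeled directed graph $(V,E,L_v,L_e,l,r)$ with vertex labels $L_v = F\cup P$ and edge labels $L_e=\{0,1\}$, in which the root $r$ is the unique vertex of indegree $0$ and the only one labeled $\mathsf{ini}$, vertices labeled $\mathsf{fin}$ are exactly those of outdegree $0$, edges leaving $F$-labeled vertices are unlabeled, $P$-labeled vertices have exactly two outgoing edges labeled with distinct values $0,1$, and every cycle contains an $F$-labeled vertex; in the interactive case additionally $\mathsf{outp}$-labeled vertices have outdegree $1$ and for every edge $(v,v')$, $l(v)=\mathsf{outp}$ iff $l(v')=\mathsf{inp}$. An interpretation $(D,D_{\mathrm{in}},D_{\mathrm{out}},I)$ assigns total computable functions: $I(\mathsf{ini}): D_{\mathrm{in}}\to D$, $I(\mathsf{fin}): D\to D_{\mathrm{out}}$, $I(f): D\to D$ for $f\in\widetilde F$, $I(p): D\to\{0,1\}$ for $p\in P$, and in the interactive case $I(\mathsf{inp}): D\times D_{\mathrm{in}}\to D$, $I(\mathsf{outp}): D\to D_{\mathrm{out}}$ ($D_{\mathrm{in}},D_{\mathrm{out}}$ finitely generated, $D$ minimal). A proto-algorithm is a triple (alphabet, graph, interpretation). States are triples $(d_{\mathrm{in}},(v,d),d_{\mathrm{out}})$ using a dummy value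 $\bot$: initial states $(d_{\mathrm{in}},(\bot,\bot),\bot)$, internal states $(\bot,(v,d),\bot)$, final states $(\bot,(\bot,\bot),d_{\mathrm{out}})$, and, for interactive proto-algorithms only, interaction states $(d_{\mathrm{in}},(v,d),d_{\mathrm{out}})$ with $l(v)=\mathsf{inp}$. The algorithmic step function $\mathrm{astep}_A$ is the smallest total function from states to nonempty sets of states such that: from $(d_{\mathrm{in}},(\bot,\bot),\bot)$ one can go to $(\bot,(v',I(\mathsf{ini})(d_{\mathrm{in}})),\bot)$ for each $(r,v')\in E$; from $(\bot,(v,d),\bot)$ with $l(v)\in\widetilde F$ to $(\bot,(v',I(l(v))(d)),\bot)$ for each $(v,v')\in E$; with $l(v)\in P$ to $(\bot,(v',d),\bot)$ for the $(v,v')\in E$ with $l((v,v'))=I(l(v))(d)$; with $l(v)=\mathsf{fin}$ to $(\bot,(\bot,\bot),I(\mathsf{fin})(d))$; final states step to themselves. In the interactive case additionally: from $(\bot,(v,d),\bot)$ with $l(v)=\mathsf{outp}$ to $(d_{\mathrm{in}},(v',d),I(\mathsf{outp})(d))$ for each $(v,v')\in E$ and every $d_{\mathrm{in}}\in D_{\mathrm{in}}$; from interaction state $(d_{\mathrm{in}},(v,d),d_{\mathrm{out}})$ with $l(v)=\mathsf{inp}$ to $(\bot,(v',I(\mathsf{inp})(d,d_{\mathrm{in}})),\bot)$ for each $(v,v')\in E$. Semi-runs from $s$: $\{\langle s\rangle\}$ if $s$ is final, otherwise all $\langle s\rangle\frown\sigma$ with $\sigma$ a semi-run from some $s'\in\mathrm{astep}_A(s)$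 (finite or countably infinite sequences). A semi-run is divergent if it has a suffix consisting only of internal states, convergent otherwise. Non-interactive case: the run set on $d_{\mathrm{in}}$ is the set of semi-runs from $(d_{\mathrm{in}},(\bot,\bot),\bot)$, the output of a convergent run is the first non-$\bot$ output component, and $\widehat{A}\subseteq D_{\mathrm{in}}\times D_{\mathrm{out}}$ contains $(d_{\mathrm{in}},d_{\mathrm{out}})$ iff some convergent run on $d_{\mathrm{in}}$ has output $d_{\mathrm{out}}$. Interactive case: for a convergent semi-run, $\mathrm{inputs}_A$ is the sequence of non-$\bot$ input components of all states except the last, and $\mathrm{outputs}_A$ is the sequence of non-$\bot$ output components (including the last state); the run set on an input sequence $\delta$ is the set of semi-runs from $(\delta[1],(\bot,\bot),\bot)$ with $\mathrm{inputs}_A=\delta$; and $\widehat{A}$ relates input sequences to output sequences, containing $(\delta_{\mathrm{in}},\delta_{\mathrm{out}})$ iff some convergent run on $\delta_{\mathrm{in}}$ has $\mathrm{outputs}_A=\delta_{\mathrm{out}}$. $\langle x\rangle$ denotes the one-element sequence. -}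

module Defs where

open import Data.Nat using (ℕ; zero; suc; _≤_; _<_)
open import Data.Fin using (Fin)
open import Data.Bool using (Bool; true; false)
open import Data.Maybe using (Maybe; just; nothing)
open import Data.List using (List; []; _∷_; _++_; map; catMaybes; applyUpTo)
open import Data.Product using (Σ; _×_; _,_)
open import Data.Sum using (_⊎_; inj₁; inj₂)
open import Data.Empty using (⊥; ⊥-elim)
open import Relation.Nullary using (¬_)
open import Relation.Binary.PropositionalEquality
open import Function.Definitions using (Injective)
open import Function.Bundles using (_⇔_; mk⇔)

-- Non-interactive alphabet (F , P): disjointness of F and P is built in
-- by using the disjoint union F ⊎ P as the type of vertex labels;
-- countability is an injection into ℕ.
record Alphabet : Set₁ where
  field
    F P      : Set
    ini fin  : F
    ini≢fin  : ini ≢ fin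
    encF     : F → ℕ
    encF-inj : Injective _≡_ _≡_ encF
    encP     : P → ℕ
    encP-inj : Injective _≡_ _≡_ encP

record IAlphabet : Set₁ where
  field
    F P            : Set
    ini fin inp outp : F
    ini≢fin        : ini ≢ fin
    ini≢inp        : ini ≢ inp
    ini≢outp       : ini ≢ outp
    fin≢inp        : fin ≢ inp
    fin≢outp       : fin ≢ outp
    inp≢outp       : inp ≢ outp
    encF           : F → ℕ
    encF-inj       : Injective _≡_ _≡_ encF
    encP           : P → ℕ
    encP-inj       : Injective _≡_ _≡_ encP

-- Graphs: vertices Fin n, edge relation E (as a Bool-valued matrix),
-- vertex labelling l into F ⊎ P, edge labelling el (Bool = {0,1};
-- nothing = unlabelled), root r.

record Graph (F P : Set) : Set where
  field
    n  : ℕ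
    E  : Fin n → Fin n → Bool
    l  : Fin n → F ⊎ P
    el : Fin n → Fin n → Maybe Bool
    r  : Fin n

-- walks of length ≥ 1 all of whose vertices (except possibly the
-- endpoint) are P-labelled; a closed one is a cycle without F-vertex
data PWalk {F P : Set} (G : Graph F P) : Fin (Graph.n G) → Fin (Graph.n G) → Set where
  one  : ∀ {u w p} → Graph.l G u ≡ inj₂ p → Graph.E G u w ≡ true → PWalk G u w
  more : ∀ {u m w p} → Graph.l G u ≡ inj₂ p → Graph.E G u m ≡ true → PWalk G m w → PWalk G u w

record IsAlgGraph {F P : Set} (ini fin : F) (G : Graph F P) : Set where
  open Graph G
  field
    root-indeg0        : ∀ v → E v r ≡ false
    root-unique        : ∀ v → (∀ u → E u v ≡ false) → v ≡ r
    root-ini           : l r ≡ inj₁ ini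
    ini-root           : ∀ v → l v ≡ inj₁ ini → v ≡ r
    fin-sink           : ∀ v → l v ≡ inj₁ fin → ∀ w → E v w ≡ false
    sink-fin           : ∀ v → (∀ w → E v w ≡ false) → l v ≡ inj₁ fin
    nonedge-unlabelled : ∀ v w → E v w ≡ false → el v w ≡ nothing
    F-unlabelled       : ∀ v w f → l v ≡ inj₁ f → el v w ≡ nothing
    P-branch           : ∀ v p → l v ≡ inj₂ p →
                         Σ (Fin n) λ w₀ → Σ (Fin n) λ w₁ →
                           w₀ ≢ w₁ × E v w₀ ≡ true × E v w₁ ≡ true ×
                           el v w₀ ≡ just false × el v w₁ ≡ just true ×
                           (∀ w → E v w ≡ true → w ≡ w₀ ⊎ w ≡ w₁)
    no-P-cycle         : ∀ v → ¬ PWalk G v v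

record IsIAlgGraph {F P : Set} (ini fin inp outp : F) (G : Graph F P) : Set where
  open Graph G
  field
    base      : IsAlgGraph ini fin G
    outp-deg1 : ∀ v → l v ≡ inj₁ outp →
                Σ (Fin n) λ w → E v w ≡ true × (∀ w' → E v w' ≡ true → w' ≡ w)
    outp-inp  : ∀ v w → E v w ≡ true → (l v ≡ inj₁ outp ⇔ l w ≡ inj₁ inp)

-- Interpretations (Agda functions are total and computable).
-- Ifun is total on F; only its values on F̃ are ever used.

record Interp (F P : Set) : Set₁ where
  field
    D Din Dout : Set
    Iini  : Din → D
    Ifin  : D → Dout
    Ifun  : F → D → D
    Ipred : P → D → Bool

record IInterp (F P : Set) : Set₁ where
  field
    D Din Dout : Set
    Iini  : Din → D
    Ifin  : D → Dout
    Ifun  : F → D → D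
    Ipred : P → D → Bool
    Iinp  : D × Din → D
    Ioutp : D → Dout

record ProtoAlg : Set₁ where
  field
    Σ' : Alphabet
  open Alphabet Σ' public
  field
    G    : Graph F P
    G-wf : IsAlgGraph ini fin G
    I    : Interp F P
  open Graph G public
  open Interp I public

record IProtoAlg : Set₁ where
  field
    Σ' : IAlphabet
  open IAlphabet Σ' public
  field
    G    : Graph F P
    G-wf : IsIAlgGraph ini fin inp outp G
    I    : IInterp F P
  open Graph G public
  open IInterp I public

-- Triples (d_in , (v , d) , d_out) with ⊥ rendered as nothing
-- (the middle pair (⊥,⊥) is nothing)

module Triples (Din V D Dout : Set) where
  St : Set
  St = Maybe Din × Maybe (V × D) × Maybe Dout

  data Final : St → Set where
    final : ∀ dout → Final (nothing , nothing , just dout)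

  data Internal : St → Set where
    internal : ∀ v d → Internal (nothing , just (v , d) , nothing)

  inC : St → Maybe Din
  inC (i , _ , _) = i

  outC : St → Maybe Dout
  outC (_ , _ , o) = o

dropLast : {X : Set} → List X → List X
dropLast []           = []
dropLast (x ∷ [])     = []
dropLast (x ∷ y ∷ xs) = x ∷ dropLast (y ∷ xs)

firstJust : {X : Set} → List (Maybe X) → Maybe X
firstJust []             = nothing
firstJust (just x ∷ _)   = just x
firstJust (nothing ∷ xs) = firstJust xs

module Runs {S : Set} (Step : S → S → Set) (Final Internal : S → Set) where
  data FinSemiRun : S → List S → Set where
    done : ∀ {s} → Final s → FinSemiRun s (s ∷ [])
    step : ∀ {s s' σ} → ¬ Final s → Step s s' → FinSemiRun s' σ → FinSemiRun s (s ∷ σ)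

  InfSemiRun : S → (ℕ → S) → Set
  InfSemiRun s σ = σ 0 ≡ s × (∀ i → ¬ Final (σ i) × Step (σ i) (σ (suc i)))

  DivFin : List S → Set
  DivFin σ = Σ (List S) λ pre → Σ S λ x → Σ (List S) λ suf →
               σ ≡ pre ++ (x ∷ suf) × Internal x × (∀ y → y ∈L suf → Internal y)
    where
      _∈L_ : S → List S → Set
      y ∈L []       = ⊥
      y ∈L (z ∷ zs) = y ≡ z ⊎ y ∈L zs

  DivInf : (ℕ → S) → Set
  DivInf σ = Σ ℕ λ k → ∀ i → k ≤ i → Internal (σ i)

  FiltersTo : {X : Set} → (S → Maybe X) → (ℕ → S) → List X → Set
  FiltersTo f σ τ = Σ ℕ λ N → catMaybes (applyUpTo (λ i → f (σ i)) N) ≡ τ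
                                × (∀ i → N ≤ i → f (σ i) ≡ nothing)

  FirstInf : {X : Set} → (S → Maybe X) → (ℕ → S) → X → Set
  FirstInf f σ x = Σ ℕ λ i → f (σ i) ≡ just x × (∀ j → j < i → f (σ j) ≡ nothing)

module NI (A : ProtoAlg) where
  open ProtoAlg A
  open Triples Din (Fin n) D Dout public

  data IsState : St → Set where
    initialS  : ∀ din → IsState (just din , nothing , nothing)
    internalS : ∀ v d → IsState (nothing , just (v , d) , nothing)
    finalS    : ∀ dout → IsState (nothing , nothing , just dout)

  data Step : St → St → Set where
    s-ini   : ∀ {din v'} → E r v' ≡ true →
              Step (just din , nothing , nothing) (nothing , just (v' , Iini din) , nothing)
    s-fun   : ∀ {v v' d f} → l v ≡ inj₁ f → f ≢ ini → f ≢ fin → E v v' ≡ true →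
              Step (nothing , just (v , d) , nothing) (nothing , just (v' , Ifun f d) , nothing)
    s-pred  : ∀ {v v' d p} → l v ≡ inj₂ p → E v v' ≡ true → el v v' ≡ just (Ipred p d) →
              Step (nothing , just (v , d) , nothing) (nothing , just (v' , d) , nothing)
    s-fin   : ∀ {v d} → l v ≡ inj₁ fin →
              Step (nothing , just (v , d) , nothing) (nothing , nothing , just (Ifin d))
    s-final : ∀ {dout} →
              Step (nothing , nothing , just dout) (nothing , nothing , just dout)

  open Runs Step Final Internal public

  initial : Din → St
  initial din = (just din , nothing , nothing)

  Ahat : Din → Dout → Set
  Ahat din dout =
      (Σ (List St) λ σ → FinSemiRun (initial din) σ × ¬ DivFin σ
                         × firstJust (map outC σ) ≡ just dout)
    ⊎ (Σ (ℕ → St) λ σ → InfSemiRun (initial din) σ × ¬ DivInf σ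
                         × FirstInf outC σ dout)

module IA (A : IProtoAlg) where
  open IProtoAlg A
  open Triples Din (Fin n) D Dout public

  data IsState : St → Set where
    initialS     : ∀ din → IsState (just din , nothing , nothing)
    internalS    : ∀ v d → IsState (nothing , just (v , d) , nothing)
    finalS       : ∀ dout → IsState (nothing , nothing , just dout)
    interactionS : ∀ din v d dout → l v ≡ inj₁ inp →
                   IsState (just din , just (v , d) , just dout)

  data Step : St → St → Set where
    s-ini   : ∀ {din v'} → E r v' ≡ true →
              Step (just din , nothing , nothing) (nothing , just (v' , Iini din) , nothing)
    s-fun   : ∀ {v v' d f} → l v ≡ inj₁ f → f ≢ ini → f ≢ fin → f ≢ inp → f ≢ outp →
              E v v' ≡ true →
              Step (nothing , just (v , d) , nothing) (nothing , just (v' , Ifun f d) , nothing)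
    s-pred  : ∀ {v v' d p} → l v ≡ inj₂ p → E v v' ≡ true → el v v' ≡ just (Ipred p d) →
              Step (nothing , just (v , d) , nothing) (nothing , just (v' , d) , nothing)
    s-fin   : ∀ {v d} → l v ≡ inj₁ fin →
              Step (nothing , just (v , d) , nothing) (nothing , nothing , just (Ifin d))
    s-final : ∀ {dout} →
              Step (nothing , nothing , just dout) (nothing , nothing , just dout)
    s-outp  : ∀ {v v' d} (din : Din) → l v ≡ inj₁ outp → E v v' ≡ true →
              Step (nothing , just (v , d) , nothing) (just din , just (v' , d) , just (Ioutp d))
    s-inp   : ∀ {din v v' d dout} → l v ≡ inj₁ inp → E v v' ≡ true →
              Step (just din , just (v , d) , just dout)
                   (nothing , just (v' , Iinp (d , din)) , nothing)

  open Runs Step Final Internal public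

  -- (δin , δout) ∈ Â for finite input/output sequences (δin nonempty,
  -- since the run starts from (δin[1] , (⊥,⊥) , ⊥))
  Ahat : List Din → List Dout → Set
  Ahat []          δout = ⊥
  Ahat (d ∷ δrest) δout =
      (Σ (List St) λ σ → FinSemiRun (just d , nothing , nothing) σ × ¬ DivFin σ
                         × catMaybes (map inC (dropLast σ)) ≡ d ∷ δrest
                         × catMaybes (map outC σ) ≡ δout)
    ⊎ (Σ (ℕ → St) λ σ → InfSemiRun (just d , nothing , nothing) σ × ¬ DivInf σ
                         × FiltersTo inC σ (d ∷ δrest)
                         × FiltersTo outC σ δout)

-- The interactive proto-algorithm A' obtained from A by adding fresh
-- symbols inp, outp (Σ' = (F ∪ {inp,outp}, P)), keeping V, E, edge
-- labels and root, with l' = l and I' extending I by I'(inp), I'(outp).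

data ExtF (F : Set) : Set where
  old   : F → ExtF F
  inpS  : ExtF F
  outpS : ExtF F

private
  old-inj : ∀ {F : Set} {f g : F} → old f ≡ old g → f ≡ g
  old-inj refl = refl

  suc-inj : ∀ {a b : ℕ} → suc a ≡ suc b → a ≡ b
  suc-inj refl = refl

extAlphabet : Alphabet → IAlphabet
extAlphabet Σ = record
  { F = ExtF F ; P = P ; ini = old ini ; fin = old fin ; inp = inpS ; outp = outpS
  ; ini≢fin = λ e → ini≢fin (old-inj e)
  ; ini≢inp = λ () ; ini≢outp = λ () ; fin≢inp = λ () ; fin≢outp = λ ()
  ; inp≢outp = λ ()
  ; encF = enc ; encF-inj = λ {x} {y} → inj x y
  ; encP = encP ; encP-inj = encP-inj }
  where
    open Alphabet Σ
    enc : ExtF F → ℕ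
    enc (old f) = suc (suc (encF f))
    enc inpS    = 0
    enc outpS   = 1
    inj : ∀ x y → enc x ≡ enc y → x ≡ y
    inj (old f) (old g) e = cong old (encF-inj (suc-inj (suc-inj e)))
    inj (old f) inpS ()
    inj (old f) outpS ()
    inj inpS (old g) ()
    inj inpS inpS e = refl
    inj inpS outpS ()
    inj outpS (old g) ()
    inj outpS inpS ()
    inj outpS outpS e = refl

extLabel : {F P : Set} → F ⊎ P → ExtF F ⊎ P
extLabel (inj₁ f) = inj₁ (old f)
extLabel (inj₂ p) = inj₂ p

extGraph : {F P : Set} → Graph F P → Graph (ExtF F) P
extGraph G = record { n = n ; E = E ; l = λ v → extLabel (l v) ; el = el ; r = r }
  where open Graph G

private
  backF : ∀ {F P : Set} {x : F ⊎ P} {f : F} → extLabel x ≡ inj₁ (old f) → x ≡ inj₁ f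
  backF {x = inj₁ g} refl = refl
  backF {x = inj₂ p} ()

  backP : ∀ {F P : Set} {x : F ⊎ P} {p : P} → extLabel x ≡ inj₂ p → x ≡ inj₂ p
  backP {x = inj₁ g} ()
  backP {x = inj₂ q} refl = refl

  noInp : ∀ {F P : Set} {x : F ⊎ P} → extLabel x ≡ inj₁ inpS → ⊥
  noInp {x = inj₁ g} ()
  noInp {x = inj₂ q} ()

  noOutp : ∀ {F P : Set} {x : F ⊎ P} → extLabel x ≡ inj₁ outpS → ⊥
  noOutp {x = inj₁ g} ()
  noOutp {x = inj₂ q} ()

  backWalk : ∀ {F P : Set} (G : Graph F P) {u w} → PWalk (extGraph G) u w → PWalk G u w
  backWalk G (one e x)    = one (backP e) x
  backWalk G (more e x w) = more (backP e) x (backWalk G w)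

extGraph-wf : {F P : Set} (ini fin : F) (G : Graph F P) → IsAlgGraph ini fin G →
              IsIAlgGraph (old ini) (old fin) inpS outpS (extGraph G)
extGraph-wf ini fin G wf = record
  { base = record
    { root-indeg0 = root-indeg0
    ; root-unique = root-unique
    ; root-ini = cong extLabel root-ini
    ; ini-root = λ v e → ini-root v (backF e)
    ; fin-sink = λ v e → fin-sink v (backF e)
    ; sink-fin = λ v h → cong extLabel (sink-fin v h)
    ; nonedge-unlabelled = nonedge-unlabelled
    ; F-unlabelled = Fu
    ; P-branch = λ v p e → P-branch v p (backP e)
    ; no-P-cycle = λ v c → no-P-cycle v (backWalk G c) }
  ; outp-deg1 = λ v e → ⊥-elim (noOutp e)
  ; outp-inp = λ v w _ → mk⇔ (λ e → ⊥-elim (noOutp e)) (λ e → ⊥-elim (noInp e)) }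
  where
    open Graph G
    open IsAlgGraph wf
    Fu : ∀ v w (f : ExtF _) → extLabel (l v) ≡ inj₁ f → el v w ≡ nothing
    Fu v w (old g) e = F-unlabelled v w g (backF e)
    Fu v w inpS e    = ⊥-elim (noInp e)
    Fu v w outpS e   = ⊥-elim (noOutp e)

extInterp : {F P : Set} (I : Interp F P) →
            (Interp.D I × Interp.Din I → Interp.D I) → (Interp.D I → Interp.Dout I) →
            IInterp (ExtF F) P
extInterp I iinp ioutp = record
  { D = D ; Din = Din ; Dout = Dout ; Iini = Iini ; Ifin = Ifin
  ; Ifun = fun ; Ipred = Ipred ; Iinp = iinp ; Ioutp = ioutp }
  where
    open Interp I
    -- values on inp/outp are never used by astep (they are special symbols)
    fun : ExtF _ → D → D
    fun (old f) = Ifun f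
    fun inpS    = λ d → d
    fun outpS   = λ d → d

extend : (A : ProtoAlg) →
         (ProtoAlg.D A × ProtoAlg.Din A → ProtoAlg.D A) →
         (ProtoAlg.D A → ProtoAlg.Dout A) → IProtoAlg
extend A iinp ioutp = record
  { Σ' = extAlphabet Σ'
  ; G = extGraph G
  ; G-wf = extGraph-wf ini fin G G-wf
  ; I = extInterp I iinp ioutp }
  where open ProtoAlg A

-- A' has no vertex labelled inp or outp, because l' is l, so the two extra
-- rules of astep_A' never fire and the step relations of A and A' coincide;
-- hence so do their semi-runs.  A run of A on d_in goes from the initial
-- state through internal states to a single final state, so its input
-- sequence is ⟨d_in⟩ and its output sequence consists of its first output
-- alone.  Finally, a finite semi-run ends in a final state, so it is never
-- divergent, whereas an infinite run of A stays among the internal states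
-- after its first step, so it is always divergent.
module Submission where

open import Defs
open import Data.Product using (_×_)
open import Data.List using (_∷_; [])
open import Function.Bundles using (_⇔_)

open import Data.Nat using (zero; suc; s≤s)
open import Data.Nat.Properties using (suc-injective)
open import Data.Maybe using (just)
open import Data.Maybe.Properties using (just-injective)
open import Data.List using (List; _++_; map; catMaybes; length)
open import Data.List.Properties using (++-assoc; ∷-injectiveˡ)
open import Data.Product using (_,_; proj₁; proj₂)
open import Data.Sum using (_⊎_; inj₁; inj₂)
open import Data.Empty using (⊥-elim)
open import Relation.Nullary using (¬_)
open import Relation.Binary.PropositionalEquality
open import Function.Base using (_∘_)
open import Function.Bundles using (mk⇔; Equivalence)

module RunsMap {S : Set} (Final Internal : S → Set) {Step Step′ : S → S → Set}
               (step⇒step′ : ∀ {s s′} → Step s s′ → Step′ s s′) where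
  private
    module R  = Runs Step Final Internal
    module R′ = Runs Step′ Final Internal

  FinSemiRun-map : ∀ {s σ} → R.FinSemiRun s σ → R′.FinSemiRun s σ
  FinSemiRun-map (R.done f)           = R′.done f
  FinSemiRun-map (R.step ¬final st r) = R′.step ¬final (step⇒step′ st) (FinSemiRun-map r)

  InfSemiRun-map : ∀ {s σ} → R.InfSemiRun s σ → R′.InfSemiRun s σ
  InfSemiRun-map (σ₀ , steps) = σ₀ , λ i → proj₁ (steps i) , step⇒step′ (proj₂ (steps i))

lastOr : {S : Set} → S → List S → S
lastOr d []       = d
lastOr d (x ∷ xs) = lastOr x xs

lastOr-∷ʳ : {S : Set} (d : S) (xs : List S) (x : S) → lastOr d (xs ++ x ∷ []) ≡ x
lastOr-∷ʳ d []       x = refl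
lastOr-∷ʳ d (y ∷ ys) x = lastOr-∷ʳ y ys x

module Convergence {S : Set} (Step : S → S → Set) (Final Internal : S → Set)
                   (final⇒¬internal : ∀ {s} → Final s → ¬ Internal s) where
  open Runs Step Final Internal

  FinSemiRun-last-final : ∀ {s σ} → FinSemiRun s σ → ∀ d → Final (lastOr d σ)
  FinSemiRun-last-final (done f)     d = f
  FinSemiRun-last-final (step _ _ r) d = FinSemiRun-last-final r _

  -- Induction on the length of the internal suffix: the membership predicate
  -- used in DivFin is local to its definition, so that suffix cannot be
  -- recursed on directly.
  DivFin-last-internal : ∀ n {σ} (δ : DivFin σ) → length (proj₁ (proj₂ (proj₂ δ))) ≡ n →
                         ∀ d → Internal (lastOr d σ)
  DivFin-last-internal _ (pre , x , [] , refl , internal-x , _) _ d =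
    subst Internal (sym (lastOr-∷ʳ d pre x)) internal-x
  DivFin-last-internal zero (_ , _ , _ ∷ _ , _) ()
  DivFin-last-internal (suc n) (pre , x , z ∷ zs , refl , _ , internal-suffix) len d =
    DivFin-last-internal n
      ( pre ++ x ∷ [] , z , zs , sym (++-assoc pre (x ∷ []) (z ∷ zs))
      , internal-suffix z (inj₁ refl) , λ y y∈zs → internal-suffix y (inj₂ y∈zs))
      (suc-injective len) d

  FinSemiRun-convergent : ∀ {s σ} → FinSemiRun s σ → ¬ DivFin σ
  FinSemiRun-convergent {s} r δ =
    final⇒¬internal (FinSemiRun-last-final r s) (DivFin-last-internal _ δ refl s)

old-injective : {F : Set} {f g : F} → old f ≡ old g → f ≡ g
old-injective refl = refl

extLabel-old⁻¹ : {F P : Set} {x : F ⊎ P} {f : F} → extLabel x ≡ inj₁ (old f) → x ≡ inj₁ f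
extLabel-old⁻¹ {x = inj₁ _} refl = refl
extLabel-old⁻¹ {x = inj₂ _} ()

extLabel-inj₂⁻¹ : {F P : Set} {x : F ⊎ P} {p : P} → extLabel x ≡ inj₂ p → x ≡ inj₂ p
extLabel-inj₂⁻¹ {x = inj₁ _} ()
extLabel-inj₂⁻¹ {x = inj₂ _} refl = refl

extLabel≢inpS : {F P : Set} {x : F ⊎ P} → extLabel x ≢ inj₁ inpS
extLabel≢inpS {x = inj₁ _} ()
extLabel≢inpS {x = inj₂ _} ()

extLabel≢outpS : {F P : Set} {x : F ⊎ P} → extLabel x ≢ inj₁ outpS
extLabel≢outpS {x = inj₁ _} ()
extLabel≢outpS {x = inj₂ _} ()

module Extension (A : ProtoAlg)
    (Iinp : ProtoAlg.D A × ProtoAlg.Din A → ProtoAlg.D A)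
    (Ioutp : ProtoAlg.D A → ProtoAlg.Dout A) where
  module N = NI A
  module N′ = IA (extend A Iinp Ioutp)
  open N using (St; Final; Internal; final; internal; initial; inC; outC)

  final⇒¬internal : ∀ {s} → Final s → ¬ Internal s
  final⇒¬internal (final _) ()

  open Convergence N′.Step Final Internal final⇒¬internal
  open RunsMap Final Internal

  step⇒step′ : ∀ {s s′} → N.Step s s′ → N′.Step s s′
  step⇒step′ (N.s-ini e)              = N′.s-ini e
  step⇒step′ (N.s-fun lv ≢ini ≢fin e) =
    N′.s-fun (cong extLabel lv) (≢ini ∘ old-injective) (≢fin ∘ old-injective) (λ ()) (λ ()) e
  step⇒step′ (N.s-pred lv e el)       = N′.s-pred (cong extLabel lv) e el
  step⇒step′ (N.s-fin lv)             = N′.s-fin (cong extLabel lv)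
  step⇒step′ N.s-final                = N′.s-final

  step′⇒step : ∀ {s s′} → N′.Step s s′ → N.Step s s′
  step′⇒step (N′.s-ini e) = N.s-ini e
  step′⇒step (N′.s-fun {f = old f} lv ≢ini ≢fin _ _ e) =
    N.s-fun (extLabel-old⁻¹ lv) (≢ini ∘ cong old) (≢fin ∘ cong old) e
  step′⇒step (N′.s-fun {f = inpS}  lv _ _ _ _ _) = ⊥-elim (extLabel≢inpS lv)
  step′⇒step (N′.s-fun {f = outpS} lv _ _ _ _ _) = ⊥-elim (extLabel≢outpS lv)
  step′⇒step (N′.s-pred lv e el)  = N.s-pred (extLabel-inj₂⁻¹ lv) e el
  step′⇒step (N′.s-fin lv)        = N.s-fin (extLabel-old⁻¹ lv)
  step′⇒step N′.s-final           = N.s-final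
  step′⇒step (N′.s-outp _ lv _)   = ⊥-elim (extLabel≢outpS lv)
  step′⇒step (N′.s-inp lv _)      = ⊥-elim (extLabel≢inpS lv)

  InternalOrFinal : St → Set
  InternalOrFinal s = Internal s ⊎ Final s

  step-from-internal : ∀ {s s′} → Internal s → N.Step s s′ → InternalOrFinal s′
  step-from-internal (internal _ _) (N.s-fun _ _ _ _) = inj₁ (internal _ _)
  step-from-internal (internal _ _) (N.s-pred _ _ _)  = inj₁ (internal _ _)
  step-from-internal (internal _ _) (N.s-fin _)       = inj₂ (final _)

  step-from-initial : ∀ {din s′} → N.Step (initial din) s′ → Internal s′
  step-from-initial (N.s-ini _) = internal _ _

  first-output⇔only-output : ∀ {s σ o} → InternalOrFinal s → N.FinSemiRun s σ →
    firstJust (map outC σ) ≡ just o ⇔ catMaybes (map outC σ) ≡ o ∷ []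
  first-output⇔only-output _ (N.done (final _)) =
    mk⇔ (cong (_∷ []) ∘ just-injective) (cong just ∘ ∷-injectiveˡ)
  first-output⇔only-output (inj₂ f) (N.step ¬final _ _) = ⊥-elim (¬final f)
  first-output⇔only-output (inj₁ i@(internal _ _)) (N.step _ st r) =
    first-output⇔only-output (step-from-internal i st) r

  no-inputs-after-start : ∀ {s σ} → InternalOrFinal s → N.FinSemiRun s σ →
                          catMaybes (map inC (dropLast σ)) ≡ []
  no-inputs-after-start _ (N.done _) = refl
  no-inputs-after-start (inj₂ f) (N.step ¬final _ _) = ⊥-elim (¬final f)
  no-inputs-after-start (inj₁ (internal _ _)) (N.step _ _ (N.done _)) = refl
  no-inputs-after-start (inj₁ i@(internal _ _)) (N.step _ st r@(N.step _ _ _)) =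
    no-inputs-after-start (step-from-internal i st) r

  run-inputs : ∀ {din σ} → N.FinSemiRun (initial din) σ →
               catMaybes (map inC (dropLast σ)) ≡ din ∷ []
  run-inputs (N.step _ (N.s-ini _) (N.done ()))
  run-inputs (N.step _ (N.s-ini _) r@(N.step _ _ _)) =
    cong (_ ∷_) (no-inputs-after-start (inj₁ (internal _ _)) r)

  run-outputs : ∀ {din σ o} → N.FinSemiRun (initial din) σ →
                firstJust (map outC σ) ≡ just o ⇔ catMaybes (map outC σ) ≡ o ∷ []
  run-outputs (N.done ())
  run-outputs (N.step _ st r) = first-output⇔only-output (inj₁ (step-from-initial st)) r

  infinite-run-divergent : ∀ {din σ} → N.InfSemiRun (initial din) σ → N.DivInf σ
  infinite-run-divergent {σ = σ} (σ₀ , steps) = 1 , λ { (suc i) (s≤s _) → internal-after i }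
    where
      internal-after : ∀ i → Internal (σ (suc i))
      internal-after zero =
        step-from-initial (subst (λ s → N.Step s (σ 1)) σ₀ (proj₂ (steps 0)))
      internal-after (suc i) with step-from-internal (internal-after i) (proj₂ (steps (suc i)))
      ... | inj₁ internal-next = internal-next
      ... | inj₂ final-next    = ⊥-elim (proj₁ (steps (suc (suc i))) final-next)

  Ahat⇔Ahat′ : ∀ din dout → N.Ahat din dout ⇔ N′.Ahat (din ∷ []) (dout ∷ [])
  Ahat⇔Ahat′ din dout = mk⇔ forward backward
    where
      forward : N.Ahat din dout → N′.Ahat (din ∷ []) (dout ∷ [])
      forward (inj₁ (σ , r , _ , first)) =
        inj₁ (σ , r′ , FinSemiRun-convergent r′ , run-inputs r , Equivalence.to (run-outputs r) first)
        where r′ = FinSemiRun-map step⇒step′ r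
      forward (inj₂ (_ , r , convergent , _)) = ⊥-elim (convergent (infinite-run-divergent r))

      backward : N′.Ahat (din ∷ []) (dout ∷ []) → N.Ahat din dout
      backward (inj₁ (σ , r′ , _ , _ , outputs)) =
        inj₁ (σ , r , FinSemiRun-convergent r′ , Equivalence.from (run-outputs r) outputs)
        where r = FinSemiRun-map step′⇒step r′
      backward (inj₂ (_ , r′ , convergent , _)) =
        ⊥-elim (convergent (infinite-run-divergent (InfSemiRun-map {Step = N′.Step} step′⇒step r′)))

corollary1 : (A : ProtoAlg)
    (Iinp : ProtoAlg.D A × ProtoAlg.Din A → ProtoAlg.D A)
    (Ioutp : ProtoAlg.D A → ProtoAlg.Dout A) →
    (∀ (s s' : NI.St A) → NI.IsState A s → NI.IsState A s' →
    (NI.Step A s s' ⇔ IA.Step (extend A Iinp Ioutp) s s'))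
    × (∀ (din : ProtoAlg.Din A) (dout : ProtoAlg.Dout A) →
    (NI.Ahat A din dout ⇔ IA.Ahat (extend A Iinp Ioutp) (din ∷ []) (dout ∷ [])))
corollary1 A Iinp Ioutp = (λ _ _ _ _ → mk⇔ step⇒step′ step′⇒step) , Ahat⇔Ahat′
  where open Extension A Iinp Ioutp
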